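{- Let $f$ be a permutation of $\Omega$ with inverse $\overline f$, let $g$ be an endomorphism of $\Omega$, and let $f(g)$ denote the endomorphism $r\mapsto f(g(\overline f(r)))$. For an ultrafilter $\mathcal U$ let $f(\mathcal U)=\{R\subseteq\Omega\mid f^{ -1}(R)\in\mathcal U\}$ (an ultrafilter). Then for all formulas $A,B,B_1,B_2$ of MRL and all ultrafilters $\mathcal U,\mathcal U_1,\mathcal U_2$: (1) $\neg_f(\neg_g(A))\Leftrightarrow\neg_{f(g)}(\neg_f(A))$; (2) $\neg_f(A\wedge_{\mathcal U}B)\Leftrightarrow\neg_f(A)\wedge_{f(\mathcal U)}\neg_f(B)$; (3) $\neg_f(\forall_{\mathcal U}(\lambda x.A))\Leftrightarrow\forall_{f(\mathcal U)}(\lambda x.\neg_f(A))$; (4) $A\wedge_{\mathcal U_1}(B_1\wedge_{\mathcal U_2}B_2)\Leftrightarrow(A\wedge_{\mathcal U_1}B_1)\wedge_{\mathcal U_2}(A\wedge_{\mathcal U_1}B_2)$.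
   Context: Fix a set $\Omega$ of roles (possibly infinite). A role set is a subset $R\subseteq\Omega$; $\overline{R}=\Omega\setminus R$; $R_1\uplus\cdots\uplus R_n=\Omega$ means the $R_i$ are pairwise disjoint with union $\Omega$. An ultrafilter on $\Omega$ is a family $\mathcal U$ of subsets of $\Omega$ with $\Omega\in\mathcal U$, closed upward and under binary intersection, and containing $R$ or $\overline R$ for every $R$. For an endomorphism $f:\Omega\to\Omega$, $f^{ -1}(R)=\{r\mid f(r)\in R\}$. Formulas of MRL, over first-order terms $t$ and variables $x$: $A,B::=a\mid\neg_f(A)\mid A\wedge_{\mathcal U}B\mid\forall_{\mathcal U}(\lambda x.A)$ ($a$ primitive formulas, $f$ endomorphisms of $\Omega$, $\mathcal U$ ultrafilters); $A[x:=t]$ is substitution. An i-formula is $R\{A\}$ with $R\subseteq\Omega$; a sequent $\Gamma$ is a finite multiset of i-formulas. Derivable sequents $\vdash\Gamma$ are generated by: (Id) $\vdash R_1\{a\},\ldots,R_n\{a\}$ whenever $R_1\uplus\cdots\uplus R_n=\Omega$; (Weaken) from $\Gamma$ infer $\Gamma,R\{A\}$; (Contract) from $\Gamma,R\{A\},R\{A\}$ infer $\Gamma,R\{A\}$; ($\neg$) from $\Gamma,f^{ -1}(R)\{A\}$ infer $\Gamma,R\{\neg_f(A)\}$; ($\wedge$-neg-l/r) if $R\notin\mathcal U$, from $\Gamma,R\{A\}$ (resp. $\Gamma,R\{B\}$) infer $\Gamma,R\{A\wedge_{\mathcal U}B\}$; ($\wedge$-pos) if $R\in\mathcal U$, from $\Gamma,R\{A\}$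 and $\Gamma,R\{B\}$ infer $\Gamma,R\{A\wedge_{\mathcal U}B\}$; ($\forall$-neg) if $R\notin\mathcal U$, from $\Gamma,R\{A[x:=t]\}$ infer $\Gamma,R\{\forall_{\mathcal U}(\lambda x.A)\}$; ($\forall$-pos) if $R\in\mathcal U$ and $x$ not free in $\Gamma$, from $\Gamma,R\{A\}$ infer $\Gamma,R\{\forall_{\mathcal U}(\lambda x.A)\}$. For formulas $A,B$, $A\Rightarrow B$ means: for every role set $R$ and every sequent $\Gamma$, if $\vdash\Gamma,R\{A\}$ is derivable then $\vdash\Gamma,R\{B\}$ is derivable; $A\Leftrightarrow B$ means both $A\Rightarrow B$ and $B\Rightarrow A$. -}

module Defs where

open import Data.Nat using (ℕ; zero; suc)
open import Data.Fin using (Fin)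
open import Data.Bool using (Bool; true; false; not; _∧_)
open import Data.Vec using (Vec; []; _∷_)
open import Data.List using (List; []; _∷_; map)
open import Data.Product using (_×_; _,_; ∃)
open import Data.Sum using (_⊎_)
open import Data.Empty using (⊥)
open import Relation.Binary.PropositionalEquality using (_≡_; refl)
open import Relation.Nullary using (¬_)
open import Data.List.Relation.Binary.Permutation.Propositional using (_↭_)
import Data.List as L

record Signature : Set₁ where
  field
    FunSym  : Set
    farity  : FunSym → ℕ
    PredSym : Set
    parity  : PredSym → ℕ

module MRL (Ω : Set) (Sig : Signature) where
  open Signature Sig

  RoleSet : Set
  RoleSet = Ω → Bool

  full : RoleSet
  full _ = true

  ∁ : RoleSet → RoleSet
  ∁ R r = not (R r)

  _⊆_ : RoleSet → RoleSet → Set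
  R ⊆ S = ∀ r → R r ≡ true → S r ≡ true

  _∩_ : RoleSet → RoleSet → RoleSet
  (R ∩ S) r = R r ∧ S r

  preimage : (Ω → Ω) → RoleSet → RoleSet
  preimage f R r = R (f r)

  record Ultrafilter : Set where
    field
      mem     : RoleSet → Bool
      full∈   : mem full ≡ true
      upward  : ∀ R S → R ⊆ S → mem R ≡ true → mem S ≡ true
      inter   : ∀ R S → mem R ≡ true → mem S ≡ true → mem (R ∩ S) ≡ true
      ultra   : ∀ R → mem R ≡ true ⊎ mem (∁ R) ≡ true
  open Ultrafilter public

  pushU : (Ω → Ω) → Ultrafilter → Ultrafilter
  pushU f U = record
    { mem    = λ R → mem U (preimage f R)
    ; full∈  = full∈ U
    ; upward = λ R S R⊆S → upward U (preimage f R) (preimage f S) (λ r → R⊆S (f r))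
    ; inter  = λ R S → inter U (preimage f R) (preimage f S)
    ; ultra  = λ R → ultra U (preimage f R)
    }

  data Term : Set where
    var : ℕ → Term
    fun : (s : FunSym) → Vec Term (farity s) → Term

  mutual
    renT : (ℕ → ℕ) → Term → Term
    renT ρ (var i)    = var (ρ i)
    renT ρ (fun s ts) = fun s (renTs ρ ts)

    renTs : ∀ {k} → (ℕ → ℕ) → Vec Term k → Vec Term k
    renTs ρ []       = []
    renTs ρ (t ∷ ts) = renT ρ t ∷ renTs ρ ts

  mutual
    subT : (ℕ → Term) → Term → Term
    subT σ (var i)    = σ i
    subT σ (fun s ts) = fun s (subTs σ ts)

    subTs : ∀ {k} → (ℕ → Term) → Vec Term k → Vec Term k
    subTs σ []       = []
    subTs σ (t ∷ ts) = subT σ t ∷ subTs σ ts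

  -- Formulas of MRL; `all U A` binds de Bruijn variable 0 in A  (∀_U(λx.A)).
  data Formula : Set where
    atom : (p : PredSym) → Vec Term (parity p) → Formula
    neg  : (Ω → Ω) → Formula → Formula
    and  : Ultrafilter → Formula → Formula → Formula
    all  : Ultrafilter → Formula → Formula

  liftR : (ℕ → ℕ) → ℕ → ℕ
  liftR ρ zero    = zero
  liftR ρ (suc i) = suc (ρ i)

  ren : (ℕ → ℕ) → Formula → Formula
  ren ρ (atom p ts) = atom p (renTs ρ ts)
  ren ρ (neg f A)   = neg f (ren ρ A)
  ren ρ (and U A B) = and U (ren ρ A) (ren ρ B)
  ren ρ (all U A)   = all U (ren (liftR ρ) A)

  liftS : (ℕ → Term) → ℕ → Term
  liftS σ zero    = var zero
  liftS σ (suc i) = renT suc (σ i)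

  sub : (ℕ → Term) → Formula → Formula
  sub σ (atom p ts) = atom p (subTs σ ts)
  sub σ (neg f A)   = neg f (sub σ A)
  sub σ (and U A B) = and U (sub σ A) (sub σ B)
  sub σ (all U A)   = all U (sub (liftS σ) A)

  -- A[x:=t] where x is the variable bound by the enclosing ∀ (index 0)
  inst0 : Term → ℕ → Term
  inst0 t zero    = t
  inst0 t (suc i) = var i

  _[_] : Formula → Term → Formula
  A [ t ] = sub (inst0 t) A

  -- i-formulas R{A} and sequents (finite multisets, as lists up to permutation)
  IFormula : Set
  IFormula = RoleSet × Formula

  Sequent : Set
  Sequent = List IFormula

  -- shift all free variables of a sequent (so that variable 0 is fresh for it)
  shiftSeq : Sequent → Sequent
  shiftSeq = map (λ { (R , A) → R , ren suc A })

  IsPartition : ∀ {k} → (Fin k → RoleSet) → Set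
  IsPartition {k} Rs =
    (∀ i j → ¬ (i ≡ j) → ∀ r → Rs i r ≡ true → Rs j r ≡ true → ⊥)
    × (∀ r → ∃ λ i → Rs i r ≡ true)

  data ⊢_ : Sequent → Set where
    Id       : ∀ {k} (Rs : Fin k → RoleSet) (p : PredSym) (ts : Vec Term (parity p)) →
               IsPartition Rs → ⊢ L.tabulate (λ i → Rs i , atom p ts)
    Exchange : ∀ {Γ Δ} → Γ ↭ Δ → ⊢ Γ → ⊢ Δ
    Weaken   : ∀ {Γ R A} → ⊢ Γ → ⊢ ((R , A) ∷ Γ)
    Contract : ∀ {Γ R A} → ⊢ ((R , A) ∷ (R , A) ∷ Γ) → ⊢ ((R , A) ∷ Γ)
    Neg      : ∀ {Γ R A f} → ⊢ ((preimage f R , A) ∷ Γ) → ⊢ ((R , neg f A) ∷ Γ)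
    AndNegL  : ∀ {Γ R A B U} → mem U R ≡ false →
               ⊢ ((R , A) ∷ Γ) → ⊢ ((R , and U A B) ∷ Γ)
    AndNegR  : ∀ {Γ R A B U} → mem U R ≡ false →
               ⊢ ((R , B) ∷ Γ) → ⊢ ((R , and U A B) ∷ Γ)
    AndPos   : ∀ {Γ R A B U} → mem U R ≡ true →
               ⊢ ((R , A) ∷ Γ) → ⊢ ((R , B) ∷ Γ) → ⊢ ((R , and U A B) ∷ Γ)
    AllNeg   : ∀ {Γ R A U} (t : Term) → mem U R ≡ false →
               ⊢ ((R , A [ t ]) ∷ Γ) → ⊢ ((R , all U A) ∷ Γ)
    AllPos   : ∀ {Γ R A U} → mem U R ≡ true →
               ⊢ ((R , A) ∷ shiftSeq Γ) → ⊢ ((R , all U A) ∷ Γ)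

  _⟹_ : Formula → Formula → Set
  A ⟹ B = ∀ (R : RoleSet) (Γ : Sequent) → ⊢ ((R , A) ∷ Γ) → ⊢ ((R , B) ∷ Γ)

  _⟺_ : Formula → Formula → Set
  A ⟺ B = (A ⟹ B) × (B ⟹ A)

  conj : (Ω → Ω) → (Ω → Ω) → (Ω → Ω) → (Ω → Ω)
  conj f f̄ g r = f (g (f̄ r))

{-# OPTIONS --safe #-}

-- The negation rule and both conjunction rules are invertible, and a negation can be pushed
-- through a quantifier. All of this comes from one replacement lemma: rewriting occurrences of
-- i-formulas in a derivation by lists of i-formulas preserves derivability, provided each
-- rewriting is compatible with the rule that introduces the rewritten formula. Every equivalence
-- is then a short chain of inversions and rules, after splitting on whether R belongs to the
-- ultrafilters involved; in (1) both sides invert to A on the role set R ∘ f ∘ g, as f̄ ∘ f = id.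

module Submission where

open import Defs
open import Data.Bool using (true; false)
open import Data.Bool.Properties using (not-¬)
open import Data.Empty using (⊥-elim)
open import Data.Fin using (Fin; zero; suc)
open import Data.List using (List; []; _∷_; _++_; concat; map; tabulate)
open import Data.List.Properties using (concat-map; concat-map-[_])
open import Data.List.Relation.Binary.Pointwise using (Pointwise; []; _∷_)
open import Data.List.Relation.Binary.Permutation.Propositional
  using (_↭_; ↭-refl; ↭-sym; ↭-trans; ↭-prep; ↭-swap)
open import Data.List.Relation.Binary.Permutation.Propositional.Properties
  using (++⁺ˡ; shift; shifts)
import Data.Nat as ℕ
open import Data.Product using (_×_; _,_; ∃)
open import Function.Bundles using (_↔_; Inverse)
open import Relation.Binary.PropositionalEquality
  using (_≡_; _≗_; refl; sym; trans; cong; subst)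
open import Relation.Nullary using (¬_)

Pointwise-↭-concat : {A B : Set} {_∼_ : A → List B → Set}
                     {xs ys : List A} {xss : List (List B)} →
                     xs ↭ ys → Pointwise _∼_ xs xss →
                     ∃ λ yss → Pointwise _∼_ ys yss × concat xss ↭ concat yss
Pointwise-↭-concat _↭_.refl rs = _ , rs , ↭-refl
Pointwise-↭-concat (_↭_.prep x π) (_∷_ {y = xs} r rs) with Pointwise-↭-concat π rs
... | yss , rs′ , π′ = xs ∷ yss , r ∷ rs′ , ++⁺ˡ xs π′
Pointwise-↭-concat (_↭_.swap x y π) (_∷_ {y = xs} r (_∷_ {y = ys} {ys = xss} s rs))
  with Pointwise-↭-concat π rs
... | yss , rs′ , π′ = ys ∷ xs ∷ yss , s ∷ r ∷ rs′ ,
                       ↭-trans (shifts xs ys {concat xss}) (++⁺ˡ ys (++⁺ˡ xs π′))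
Pointwise-↭-concat (_↭_.trans π ρ) rs with Pointwise-↭-concat π rs
... | yss , rs′ , π′ with Pointwise-↭-concat ρ rs′
...   | zss , rs″ , ρ′ = zss , rs″ , ↭-trans π′ ρ′

module Calculus (Ω : Set) (Sig : Signature) where
  open MRL Ω Sig

  mem-resp-≗ : ∀ U {R S b} → R ≗ S → mem U R ≡ b → mem U S ≡ b
  mem-resp-≗ U {R} {S} {true}  R≗S R∈U = upward U R S (λ r → trans (sym (R≗S r))) R∈U
  mem-resp-≗ U {R} {S} {false} R≗S R∉U with mem U S in S∈U
  ... | false = refl
  ... | true  = trans (sym (upward U S R (λ r → trans (R≗S r)) S∈U)) R∉U

  IsPartition-cong : ∀ {k} {Rs Ss : Fin k → RoleSet} → (∀ i → Rs i ≗ Ss i) →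
                     IsPartition Rs → IsPartition Ss
  IsPartition-cong Rs≗Ss (disjoint , cover) =
      (λ i j i≢j r p q → disjoint i j i≢j r (trans (Rs≗Ss i r) p) (trans (Rs≗Ss j r) q))
    , (λ r → let i , p = cover r in i , trans (sym (Rs≗Ss i r)) p)

  weaken-++ : ∀ Δ {Γ} → ⊢ Γ → ⊢ (Δ ++ Γ)
  weaken-++ []      d = d
  weaken-++ (_ ∷ Δ) d = Weaken (weaken-++ Δ d)

  contract-++ : ∀ Δ {Γ} → ⊢ (Δ ++ Δ ++ Γ) → ⊢ (Δ ++ Γ)
  contract-++ []      d = d
  contract-++ (x ∷ Δ) {Γ} d =
    Exchange (shift x Δ Γ)
      (contract-++ Δ
        (Exchange (↭-trans (↭-sym (shift x Δ (Δ ++ Γ))) (++⁺ˡ Δ (↭-sym (shift x Δ Γ))))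
          (Contract (Exchange (↭-prep x (shift x Δ (Δ ++ Γ))) d))))

  -- A record rather than a function type, so that Δ and Δ′ can be inferred along chains.
  record _⇛_ (Δ Δ′ : Sequent) : Set where
    infixr 2 _⟨$⟩_
    field _⟨$⟩_ : ∀ {Γ} → ⊢ (Δ ++ Γ) → ⊢ (Δ′ ++ Γ)
  open _⇛_

  infixr 5 _⨾_

  _⨾_ : ∀ {Δ₁ Δ₂ Δ₃} → Δ₁ ⇛ Δ₂ → Δ₂ ⇛ Δ₃ → Δ₁ ⇛ Δ₃
  s ⨾ t = record { _⟨$⟩_ = λ d → t ⟨$⟩ s ⟨$⟩ d }

  rule : ∀ {x y Δ} → (∀ {Γ} → ⊢ (x ∷ Γ) → ⊢ (y ∷ Γ)) → (x ∷ Δ) ⇛ (y ∷ Δ)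
  rule r = record { _⟨$⟩_ = r }

  under : ∀ {x Δ Δ′} → Δ ⇛ Δ′ → (x ∷ Δ) ⇛ (x ∷ Δ′)
  under {x} {Δ} {Δ′} t = record
    { _⟨$⟩_ = λ {Γ} d → Exchange (shift x Δ′ Γ) (t ⟨$⟩ Exchange (↭-sym (shift x Δ Γ)) d) }

  exchange : ∀ {x y Δ} → (x ∷ y ∷ Δ) ⇛ (y ∷ x ∷ Δ)
  exchange {x} {y} = record { _⟨$⟩_ = Exchange (↭-swap x y ↭-refl) }

  weaken : ∀ {x Δ} → Δ ⇛ (x ∷ Δ)
  weaken = record { _⟨$⟩_ = Weaken }

  contract : ∀ {x Δ} → (x ∷ x ∷ Δ) ⇛ (x ∷ Δ)
  contract = record { _⟨$⟩_ = Contract }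

  andPos-intro : ∀ {R U A B Δ Θ} → mem U R ≡ true →
                 Δ ⇛ ((R , A) ∷ Θ) → Δ ⇛ ((R , B) ∷ Θ) → Δ ⇛ ((R , and U A B) ∷ Θ)
  andPos-intro m s t = record { _⟨$⟩_ = λ d → AndPos m (s ⟨$⟩ d) (t ⟨$⟩ d) }

  andNeg-intro : ∀ {R U A B Δ} → mem U R ≡ false →
                 ((R , A) ∷ (R , B) ∷ Δ) ⇛ ((R , and U A B) ∷ Δ)
  andNeg-intro m = under (rule (AndNegR m)) ⨾ rule (AndNegL m) ⨾ contract

  module Replacement (_▷_ : IFormula → List IFormula → Set) where

    data _↝_ : IFormula → List IFormula → Set where
      same : ∀ {R R′ A} → R ≗ R′ → (R , A) ↝ ((R′ , A) ∷ [])
      step : ∀ {x ys} → x ▷ ys → x ↝ ys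

    Replaceable : IFormula → Sequent → Set
    Replaceable x Γ = ∀ {ys} → x ↝ ys → ⊢ (ys ++ Γ)

    -- Only occurrences introduced by the last rule need a case: all others are carried along
    -- by the induction on derivations.
    record IsAdmissible : Set where
      field
        ▷-atom    : ∀ {R p ts ys} → ¬ ((R , atom p ts) ▷ ys)
        ▷-ren-suc : ∀ {R A ys} → (R , A) ▷ ys → (R , ren ℕ.suc A) ▷ shiftSeq ys
        ▷-Neg     : ∀ {R f A ys Γ} → (R , neg f A) ▷ ys →
                    Replaceable (preimage f R , A) Γ → ⊢ (ys ++ Γ)
        ▷-AndNegL : ∀ {R U A B ys Γ} → mem U R ≡ false → (R , and U A B) ▷ ys →
                    Replaceable (R , A) Γ → ⊢ (ys ++ Γ)
        ▷-AndNegR : ∀ {R U A B ys Γ} → mem U R ≡ false → (R , and U A B) ▷ ys →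
                    Replaceable (R , B) Γ → ⊢ (ys ++ Γ)
        ▷-AndPos  : ∀ {R U A B ys Γ} → mem U R ≡ true → (R , and U A B) ▷ ys →
                    Replaceable (R , A) Γ → Replaceable (R , B) Γ → ⊢ (ys ++ Γ)
        ▷-AllNeg  : ∀ {R U A ys Γ} t → mem U R ≡ false → (R , all U A) ▷ ys →
                    Replaceable (R , A [ t ]) Γ → ⊢ (ys ++ Γ)
        ▷-AllPos  : ∀ {R U A ys Γ} → mem U R ≡ true → (R , all U A) ▷ ys →
                    Replaceable (R , A) (shiftSeq Γ) → ⊢ (ys ++ Γ)

    ↝-refl : ∀ Γ → Pointwise _↝_ Γ (map (_∷ []) Γ)
    ↝-refl []      = []
    ↝-refl (_ ∷ Γ) = same (λ _ → refl) ∷ ↝-refl Γ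

    module _ (admissible : IsAdmissible) where
      open IsAdmissible admissible

      ↝-ren-suc : ∀ {R A ys} → (R , A) ↝ ys → (R , ren ℕ.suc A) ↝ shiftSeq ys
      ↝-ren-suc (same R≗R′) = same R≗R′
      ↝-ren-suc (step s)    = step (▷-ren-suc s)

      ↝-shiftSeq : ∀ {Γ Δs} → Pointwise _↝_ Γ Δs → Pointwise _↝_ (shiftSeq Γ) (map shiftSeq Δs)
      ↝-shiftSeq []       = []
      ↝-shiftSeq (r ∷ rs) = ↝-ren-suc r ∷ ↝-shiftSeq rs

      atoms-same : ∀ {k p ts} (Rs : Fin k → RoleSet) {Δs} →
                   Pointwise _↝_ (tabulate (λ i → Rs i , atom p ts)) Δs →
                   ∃ λ (Ss : Fin k → RoleSet) →
                     (∀ i → Rs i ≗ Ss i) × concat Δs ≡ tabulate (λ i → Ss i , atom p ts)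
      atoms-same {ℕ.zero}  Rs []              = (λ ()) , (λ ()) , refl
      atoms-same {ℕ.suc k} Rs (step s ∷ _)    = ⊥-elim (▷-atom s)
      atoms-same {ℕ.suc k} {p} {ts} Rs (same {R′ = S} R≗S ∷ rs) =
        let Ss , Rs≗Ss , eq = atoms-same (λ i → Rs (suc i)) rs
        in  (λ { zero → S ; (suc i) → Ss i })
          , (λ { zero → R≗S ; (suc i) → Rs≗Ss i })
          , cong ((S , atom p ts) ∷_) eq

      mutual
        replace : ∀ {Γ Δs} → ⊢ Γ → Pointwise _↝_ Γ Δs → ⊢ concat Δs
        replace (Id Rs p ts partition) rs =
          let Ss , Rs≗Ss , eq = atoms-same Rs rs
          in  subst ⊢_ (sym eq) (Id Ss p ts (IsPartition-cong Rs≗Ss partition))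
        replace (Exchange π d) rs =
          let Δs′ , rs′ , π′ = Pointwise-↭-concat (↭-sym π) rs
          in  Exchange (↭-sym π′) (replace d rs′)
        replace (Weaken d)   (_∷_ {y = ys} _ rs) = weaken-++ ys (replace d rs)
        replace (Contract d) (_∷_ {y = ys} r rs) = contract-++ ys (replace d (r ∷ r ∷ rs))
        replace (Neg {f = f} d) (same R≗R′ ∷ rs) = Neg (premise d rs (same (λ r → R≗R′ (f r))))
        replace (Neg d)         (step s ∷ rs)     = ▷-Neg s (premise d rs)
        replace (AndNegL {U = U} m d) (same R≗R′ ∷ rs) =
          AndNegL (mem-resp-≗ U R≗R′ m) (premise d rs (same R≗R′))
        replace (AndNegL m d) (step s ∷ rs) = ▷-AndNegL m s (premise d rs)
        replace (AndNegR {U = U} m d) (same R≗R′ ∷ rs) =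
          AndNegR (mem-resp-≗ U R≗R′ m) (premise d rs (same R≗R′))
        replace (AndNegR m d) (step s ∷ rs) = ▷-AndNegR m s (premise d rs)
        replace (AndPos {U = U} m d e) (same R≗R′ ∷ rs) =
          AndPos (mem-resp-≗ U R≗R′ m) (premise d rs (same R≗R′))
                                       (premise e rs (same R≗R′))
        replace (AndPos m d e) (step s ∷ rs) = ▷-AndPos m s (premise d rs) (premise e rs)
        replace (AllNeg {U = U} t m d) (same R≗R′ ∷ rs) =
          AllNeg t (mem-resp-≗ U R≗R′ m) (premise d rs (same R≗R′))
        replace (AllNeg t m d) (step s ∷ rs) = ▷-AllNeg t m s (premise d rs)
        replace (AllPos {U = U} m d) (same R≗R′ ∷ rs) =
          AllPos (mem-resp-≗ U R≗R′ m) (shifted-premise d rs (same R≗R′))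
        replace (AllPos m d) (step s ∷ rs) = ▷-AllPos m s (shifted-premise d rs)

        premise : ∀ {x Γ Δs} → ⊢ (x ∷ Γ) → Pointwise _↝_ Γ Δs → Replaceable x (concat Δs)
        premise d rs r = replace d (r ∷ rs)

        shifted-premise : ∀ {x Γ Δs} → ⊢ (x ∷ shiftSeq Γ) → Pointwise _↝_ Γ Δs →
                          Replaceable x (shiftSeq (concat Δs))
        shifted-premise {Δs = Δs} d rs {ys} r =
          subst (λ Θ → ⊢ (ys ++ Θ)) (concat-map Δs) (replace d (r ∷ ↝-shiftSeq rs))

      replace-head : ∀ {x ys Γ} → x ↝ ys → ⊢ (x ∷ Γ) → ⊢ (ys ++ Γ)
      replace-head {ys = ys} {Γ} r d =
        subst (λ Θ → ⊢ (ys ++ Θ)) (concat-map-[ Γ ]) (replace d (r ∷ ↝-refl Γ))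

  data Invertible : IFormula → List IFormula → Set where
    Neg-inv     : ∀ {R f A} → Invertible (R , neg f A) ((preimage f R , A) ∷ [])
    AndPos-invˡ : ∀ {R U A B} → mem U R ≡ true → Invertible (R , and U A B) ((R , A) ∷ [])
    AndPos-invʳ : ∀ {R U A B} → mem U R ≡ true → Invertible (R , and U A B) ((R , B) ∷ [])
    AndNeg-inv  : ∀ {R U A B} → mem U R ≡ false →
                  Invertible (R , and U A B) ((R , A) ∷ (R , B) ∷ [])

  module Inversion = Replacement Invertible

  invertible-admissible : Inversion.IsAdmissible
  invertible-admissible = record
    { ▷-atom    = λ ()
    ; ▷-ren-suc = λ { Neg-inv → Neg-inv
                    ; (AndPos-invˡ m) → AndPos-invˡ m
                    ; (AndPos-invʳ m) → AndPos-invʳ m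
                    ; (AndNeg-inv m)  → AndNeg-inv m }
    ; ▷-Neg     = λ { Neg-inv k → k ≗same }
    ; ▷-AndNegL = λ { m (AndPos-invˡ m′) _ → ⊥-elim (not-¬ m′ m)
                    ; m (AndPos-invʳ m′) _ → ⊥-elim (not-¬ m′ m)
                    ; _ (AndNeg-inv _)   k → Exchange (↭-swap _ _ ↭-refl) (Weaken (k ≗same)) }
    ; ▷-AndNegR = λ { m (AndPos-invˡ m′) _ → ⊥-elim (not-¬ m′ m)
                    ; m (AndPos-invʳ m′) _ → ⊥-elim (not-¬ m′ m)
                    ; _ (AndNeg-inv _)   k → Weaken (k ≗same) }
    ; ▷-AndPos  = λ { _ (AndPos-invˡ _) k _ → k ≗same
                    ; _ (AndPos-invʳ _) _ k → k ≗same
                    ; m (AndNeg-inv m′) _ _ → ⊥-elim (not-¬ m m′) }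
    ; ▷-AllNeg  = λ _ _ ()
    ; ▷-AllPos  = λ _ ()
    }
    where ≗same = λ {R} {A} → Inversion.same {R} {R} {A} (λ _ → refl)

  invert : ∀ {x ys Γ} → Invertible x ys → ⊢ (x ∷ Γ) → ⊢ (ys ++ Γ)
  invert r = Inversion.replace-head invertible-admissible (Inversion.step r)

  neg-elim : ∀ {R f A Δ} → ((R , neg f A) ∷ Δ) ⇛ ((preimage f R , A) ∷ Δ)
  neg-elim = rule (invert Neg-inv)

  andPos-elimˡ : ∀ {R U A B Δ} → mem U R ≡ true → ((R , and U A B) ∷ Δ) ⇛ ((R , A) ∷ Δ)
  andPos-elimˡ m = rule (invert (AndPos-invˡ m))

  andPos-elimʳ : ∀ {R U A B Δ} → mem U R ≡ true → ((R , and U A B) ∷ Δ) ⇛ ((R , B) ∷ Δ)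
  andPos-elimʳ m = rule (invert (AndPos-invʳ m))

  andNeg-elim : ∀ {R U A B Δ} → mem U R ≡ false →
                ((R , and U A B) ∷ Δ) ⇛ ((R , A) ∷ (R , B) ∷ Δ)
  andNeg-elim m = record { _⟨$⟩_ = invert (AndNeg-inv m) }

  role-cong : ∀ {R S A Δ} → R ≗ S → ((R , A) ∷ Δ) ⇛ ((S , A) ∷ Δ)
  role-cong R≗S = rule (Inversion.replace-head invertible-admissible (Inversion.same R≗S))

  data NegAllCommuting : IFormula → List IFormula → Set where
    push-neg : ∀ {R f U A} →
               NegAllCommuting (preimage f R , all U A) ((R , all (pushU f U) (neg f A)) ∷ [])
    pull-neg : ∀ {R f U A} →
               NegAllCommuting (R , all (pushU f U) (neg f A)) ((R , neg f (all U A)) ∷ [])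

  module Commutation = Replacement NegAllCommuting

  negAllCommuting-admissible : Commutation.IsAdmissible
  negAllCommuting-admissible = record
    { ▷-atom    = λ ()
    ; ▷-ren-suc = λ { push-neg → push-neg ; pull-neg → pull-neg }
    ; ▷-Neg     = λ ()
    ; ▷-AndNegL = λ _ ()
    ; ▷-AndNegR = λ _ ()
    ; ▷-AndPos  = λ _ ()
    ; ▷-AllNeg  = λ { t m push-neg k → AllNeg t m (Neg (k ≗same))
                    ; t m pull-neg k → Neg (AllNeg t m (invert Neg-inv (k ≗same))) }
    ; ▷-AllPos  = λ { m push-neg k → AllPos m (Neg (k ≗same))
                    ; m pull-neg k → Neg (AllPos m (invert Neg-inv (k ≗same))) }
    }
    where ≗same = λ {R} {A} → Commutation.same {R} {R} {A} (λ _ → refl)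

  commute : ∀ {x ys Δ} → NegAllCommuting x (ys ∷ []) → (x ∷ Δ) ⇛ (ys ∷ Δ)
  commute r = rule (Commutation.replace-head negAllCommuting-admissible (Commutation.step r))

  ⇛⇒⟹ : ∀ {A B} → (∀ R → ((R , A) ∷ []) ⇛ ((R , B) ∷ [])) → A ⟹ B
  ⇛⇒⟹ t R Γ d = t R ⟨$⟩ d

  neg-neg-⇛ : ∀ {f g h k A R} → (∀ r → f (g r) ≡ h (k r)) →
              ((R , neg f (neg g A)) ∷ []) ⇛ ((R , neg h (neg k A)) ∷ [])
  neg-neg-⇛ {R = R} fg≗hk =
    neg-elim ⨾ neg-elim ⨾ role-cong (λ r → cong R (fg≗hk r)) ⨾ rule Neg ⨾ rule Neg

  neg-neg-conj : ∀ f f̄ g A → (∀ r → f̄ (f r) ≡ r) →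
                 neg f (neg g A) ⟺ neg (conj f f̄ g) (neg f A)
  neg-neg-conj f f̄ g A f̄∘f≗id =
      ⇛⇒⟹ (λ _ → neg-neg-⇛ (λ r → cong (λ s → f (g s)) (sym (f̄∘f≗id r))))
    , ⇛⇒⟹ (λ _ → neg-neg-⇛ (λ r → cong (λ s → f (g s)) (f̄∘f≗id r)))

  neg-and : ∀ f U A B → neg f (and U A B) ⟺ and (pushU f U) (neg f A) (neg f B)
  neg-and f U A B = ⇛⇒⟹ push , ⇛⇒⟹ pull
    where
    push : ∀ R → ((R , neg f (and U A B)) ∷ []) ⇛
                 ((R , and (pushU f U) (neg f A) (neg f B)) ∷ [])
    push R with mem U (preimage f R) in m
    ... | true  =
      neg-elim ⨾ andPos-intro m (andPos-elimˡ m ⨾ rule Neg) (andPos-elimʳ m ⨾ rule Neg)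
    ... | false = neg-elim ⨾ andNeg-elim m ⨾ rule Neg ⨾ under (rule Neg) ⨾ andNeg-intro m

    pull : ∀ R → ((R , and (pushU f U) (neg f A) (neg f B)) ∷ []) ⇛
                 ((R , neg f (and U A B)) ∷ [])
    pull R with mem U (preimage f R) in m
    ... | true  =
      andPos-intro m (andPos-elimˡ m ⨾ neg-elim) (andPos-elimʳ m ⨾ neg-elim) ⨾ rule Neg
    ... | false = andNeg-elim m ⨾ neg-elim ⨾ under neg-elim ⨾ andNeg-intro m ⨾ rule Neg

  neg-all : ∀ f U A → neg f (all U A) ⟺ all (pushU f U) (neg f A)
  neg-all f U A = ⇛⇒⟹ (λ _ → neg-elim ⨾ commute push-neg) , ⇛⇒⟹ (λ _ → commute pull-neg)

  and-distribˡ-and : ∀ U₁ U₂ A B₁ B₂ →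
                     and U₁ A (and U₂ B₁ B₂) ⟺ and U₂ (and U₁ A B₁) (and U₁ A B₂)
  and-distribˡ-and U₁ U₂ A B₁ B₂ = ⇛⇒⟹ distribute , ⇛⇒⟹ collect
    where
    distribute : ∀ R → ((R , and U₁ A (and U₂ B₁ B₂)) ∷ []) ⇛
                       ((R , and U₂ (and U₁ A B₁) (and U₁ A B₂)) ∷ [])
    distribute R with mem U₁ R in m₁ | mem U₂ R in m₂
    ... | true  | true  =
      andPos-intro m₂
        (andPos-intro m₁ (andPos-elimˡ m₁) (andPos-elimʳ m₁ ⨾ andPos-elimˡ m₂))
        (andPos-intro m₁ (andPos-elimˡ m₁) (andPos-elimʳ m₁ ⨾ andPos-elimʳ m₂))
    ... | true  | false =
      andPos-intro m₁
        (andPos-elimˡ m₁ ⨾ under weaken)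
        (andPos-intro m₁ (andPos-elimˡ m₁ ⨾ under weaken)
                         (andPos-elimʳ m₁ ⨾ andNeg-elim m₂ ⨾ exchange) ⨾ exchange)
      ⨾ andNeg-intro m₂
    ... | false | true  =
      andNeg-elim m₁ ⨾
      andPos-intro m₂ (under (andPos-elimˡ m₂) ⨾ andNeg-intro m₁)
                      (under (andPos-elimʳ m₂) ⨾ andNeg-intro m₁)
    ... | false | false =
      andNeg-elim m₁ ⨾ under (andNeg-elim m₂) ⨾ weaken ⨾ under exchange ⨾
      andNeg-intro m₁ ⨾ under (andNeg-intro m₁) ⨾ andNeg-intro m₂

    collect : ∀ R → ((R , and U₂ (and U₁ A B₁) (and U₁ A B₂)) ∷ []) ⇛
                    ((R , and U₁ A (and U₂ B₁ B₂)) ∷ [])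
    collect R with mem U₁ R in m₁ | mem U₂ R in m₂
    ... | true  | true  =
      andPos-intro m₁
        (andPos-elimˡ m₂ ⨾ andPos-elimˡ m₁)
        (andPos-intro m₂ (andPos-elimˡ m₂ ⨾ andPos-elimʳ m₁)
                         (andPos-elimʳ m₂ ⨾ andPos-elimʳ m₁))
    ... | true  | false =
      andNeg-elim m₂ ⨾
      andPos-intro m₁ (andPos-elimˡ m₁ ⨾ under (andPos-elimˡ m₁) ⨾ contract)
                      (andPos-elimʳ m₁ ⨾ under (andPos-elimʳ m₁) ⨾ andNeg-intro m₂)
    ... | false | true  =
      andPos-intro m₂ (andPos-elimˡ m₂ ⨾ andNeg-elim m₁ ⨾ exchange)
                      (andPos-elimʳ m₂ ⨾ andNeg-elim m₁ ⨾ exchange)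
      ⨾ exchange ⨾ andNeg-intro m₁
    ... | false | false =
      andNeg-elim m₂ ⨾ under (andNeg-elim m₁) ⨾ andNeg-elim m₁ ⨾ under exchange ⨾ contract ⨾
      under (andNeg-intro m₂) ⨾ andNeg-intro m₁

proposition5 : (Ω : Set) (Sig : Signature) →
    let open MRL Ω Sig in
    (f : Ω ↔ Ω) (g : Ω → Ω)
    (A B B₁ B₂ : Formula) (U U₁ U₂ : Ultrafilter) →
    let fₜ = Inverse.to f
        f̄ = Inverse.from f in
      (neg fₜ (neg g A) ⟺ neg (conj fₜ f̄ g) (neg fₜ A))
    × (neg fₜ (and U A B) ⟺ and (pushU fₜ U) (neg fₜ A) (neg fₜ B))
    × (neg fₜ (all U A) ⟺ all (pushU fₜ U) (neg fₜ A))
    × (and U₁ A (and U₂ B₁ B₂) ⟺ and U₂ (and U₁ A B₁) (and U₁ A B₂))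
proposition5 Ω Sig f g A B B₁ B₂ U U₁ U₂ =
    neg-neg-conj (Inverse.to f) (Inverse.from f) g A (Inverse.strictlyInverseʳ f)
  , neg-and (Inverse.to f) U A B
  , neg-all (Inverse.to f) U A
  , and-distribˡ-and U₁ U₂ A B₁ B₂
  where open Calculus Ω Sig
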